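{- Let $L$ be a dense linear order with no least element. Let $g$ be a finite partial automorphism of $L$ and let $a,b\in L$ be such that $b\leq g(a)\leq a$. Then there are $d_1,d_2\in L$ such that $g\cup\{(d_1,b),(b,d_2)\}$ is a partial automorphism of $L$.
   Context: A partial automorphism of a linear order is a partial map preserving quantifier-free types over $\emptyset$ (i.e.\ an order-preserving injective partial map); it is finite if its domain is finite. -}

module Defs where

open import Level using (_⊔_)
open import Data.Product using (_×_; _,_; proj₁; proj₂; ∃-syntax)
open import Data.Sum using (_⊎_)
open import Data.List using (List)
open import Data.List.Membership.Propositional using (_∈_)
open import Function.Bundles using (_⇔_)
open import Relation.Binary.Bundles using (StrictTotalOrder)

module _ {c ℓ₁ ℓ₂} (L : StrictTotalOrder c ℓ₁ ℓ₂) where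
  open StrictTotalOrder L renaming (Carrier to A)

  _≤L_ : A → A → Set (ℓ₁ ⊔ ℓ₂)
  x ≤L y = x < y ⊎ x ≈ y

  Dense : Set (c ⊔ ℓ₂)
  Dense = ∀ x y → x < y → ∃[ z ] (x < z × z < y)

  NoLeast : Set (c ⊔ ℓ₂)
  NoLeast = ∀ x → ∃[ y ] (y < x)

  -- A finite partial map is given by its (finite) graph, a list of pairs
  -- (x , g x).  It is a partial automorphism iff it preserves the
  -- quantifier-free type over ∅ of every pair of points of its domain,
  -- i.e. equality and order (this also forces it to be a well-defined
  -- injective function).
  IsPartialAut : List (A × A) → Set (c ⊔ ℓ₁ ⊔ ℓ₂)
  IsPartialAut g = ∀ {p q} → p ∈ g → q ∈ g →
    ((proj₁ p ≈ proj₁ q) ⇔ (proj₂ p ≈ proj₂ q)) ×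
    ((proj₁ p < proj₁ q) ⇔ (proj₂ p < proj₂ q))

-- Each new pair (u , v) is found by the back-and-forth step: if u is already in
-- the domain, reuse its image; otherwise v must lie strictly between the images
-- of the domain points below u and those above u, and such a v exists by density
-- (no least element covers the case that nothing lies below u).  Since b ≤ g(a),
-- the step applied to g⁻¹ at b yields d₁; since b ≤ a, the step applied to the
-- extended map at b yields d₂.
module Submission where

open import Defs
open import Data.Empty using (⊥-elim)
open import Data.List using (List; _∷_; map; filter)
open import Data.List.Extrema using (min; max; argmin-all; argmax-all; min≤xs; xs≤max)
open import Data.List.Membership.Propositional using (_∈_; find; lose)
open import Data.List.Membership.Propositional.Properties using (∈-map⁺; ∈-map⁻; ∈-filter⁺; ∈-filter⁻)
open import Data.List.Relation.Binary.Permutation.Propositional using (↭-refl) renaming (swap to ↭-swap)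
open import Data.List.Relation.Binary.Permutation.Propositional.Properties using (∈-resp-↭)
open import Data.List.Relation.Binary.Subset.Propositional using (_⊆_)
open import Data.List.Relation.Unary.All as All using (All)
open import Data.List.Relation.Unary.Any using (Any; here; there; any?)
open import Data.Product using (_×_; _,_; proj₁; proj₂; ∃-syntax; swap)
open import Data.Sum using (inj₁; inj₂)
open import Function using (_∘_; id)
open import Level using (_⊔_)
open import Function.Bundles using (_⇔_; mk⇔; Equivalence)
open import Function.Construct.Symmetry using (⇔-sym)
open import Relation.Binary.Bundles using (StrictTotalOrder; DecTotalOrder; TotalOrder)
open import Relation.Binary.Definitions using (tri<; tri≈; tri>)
import Relation.Binary.Construct.StrictToNonStrict as StrictToNonStrict
import Relation.Binary.Properties.StrictTotalOrder as StrictTotalOrderProperties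
open import Relation.Binary.PropositionalEquality using () renaming (refl to ≡-refl)
open import Relation.Nullary using (¬_; yes; no)

module _ {c ℓ₁ ℓ₂} (L : StrictTotalOrder c ℓ₁ ℓ₂) where
  open StrictTotalOrder L renaming (Carrier to A)
  open Equivalence using (to; from)

  private
    totalOrder : TotalOrder c ℓ₁ (ℓ₁ ⊔ ℓ₂)
    totalOrder = DecTotalOrder.totalOrder (StrictTotalOrderProperties.decTotalOrder L)
    _≤_ : A → A → Set (ℓ₁ ⊔ ℓ₂)
    _≤_ = _≤L_ L

  <-≤L-trans : ∀ {x y z} → x < y → y ≤ z → x < z
  <-≤L-trans = StrictToNonStrict.<-≤-trans _≈_ _<_ trans <-respʳ-≈

  ≤L-<-trans : ∀ {x y z} → x ≤ y → y < z → x < z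
  ≤L-<-trans = StrictToNonStrict.≤-<-trans _≈_ _<_ Eq.sym trans <-respˡ-≈

  ≤L-trans : ∀ {x y z} → x ≤ y → y ≤ z → x ≤ z
  ≤L-trans = StrictToNonStrict.trans _≈_ _<_ isEquivalence <-resp-≈ trans

  interpolate : Dense L → NoLeast L → ∀ {t los his} → t ∈ his →
    All (λ l → All (l <_) his) los → ∃[ v ] (All (_< v) los × All (v <_) his)
  interpolate dense noleast {t} {los} {his} t∈his los<his =
    let v , M<v , v<m = dense M m (argmax-all totalOrder id w<m los<m)
    in v , All.map (λ l≤M → ≤L-<-trans l≤M M<v) (xs≤max totalOrder w los)
         , All.map (<-≤L-trans v<m) (min≤xs totalOrder t his)
    where
    m : A
    m = min totalOrder t his

    w : A
    w = proj₁ (noleast m)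

    w<m : w < m
    w<m = proj₂ (noleast m)

    M : A
    M = max totalOrder w los

    los<m : All (_< m) los
    los<m = All.map (λ l<his → argmin-all totalOrder id (All.lookup l<his t∈his) l<his) los<his

  Compatible : A × A → A × A → Set (ℓ₁ ⊔ ℓ₂)
  Compatible p q = ((proj₁ p ≈ proj₁ q) ⇔ (proj₂ p ≈ proj₂ q)) ×
                   ((proj₁ p < proj₁ q) ⇔ (proj₂ p < proj₂ q))

  compatible-refl : ∀ p → Compatible p p
  compatible-refl p = mk⇔ (λ _ → Eq.refl) (λ _ → Eq.refl)
                    , mk⇔ (⊥-elim ∘ irrefl Eq.refl) (⊥-elim ∘ irrefl Eq.refl)

  private
    converse-< : ∀ {x x′ y y′} → (x ≈ x′ ⇔ y ≈ y′) → (x < x′ ⇔ y < y′) → x′ < x → y′ < y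
    converse-< {y = y} {y′} e o x′<x with compare y′ y
    ... | tri< y′<y _ _ = y′<y
    ... | tri≈ _ y′≈y _ = ⊥-elim (irrefl (Eq.sym (from e (Eq.sym y′≈y))) x′<x)
    ... | tri> _ _ y<y′ = ⊥-elim (asym x′<x (from o y<y′))

  compatible-sym : ∀ {p q} → Compatible p q → Compatible q p
  compatible-sym (e , o) = mk⇔ (Eq.sym ∘ to e ∘ Eq.sym) (Eq.sym ∘ from e ∘ Eq.sym)
                         , mk⇔ (converse-< e o) (converse-< (⇔-sym e) (⇔-sym o))

  compatible-respˡ : ∀ {x u y q} → x ≈ u → Compatible (x , y) q → Compatible (u , y) q
  compatible-respˡ x≈u (e , o) = mk⇔ (to e ∘ Eq.trans x≈u) (Eq.trans (Eq.sym x≈u) ∘ from e)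
                               , mk⇔ (to o ∘ <-respˡ-≈ (Eq.sym x≈u)) (<-respˡ-≈ x≈u ∘ from o)

  compatible-separated : ∀ {u v x y} → ¬ u ≈ x → (x < u → y < v) → (u < x → v < y) →
    Compatible (u , v) (x , y)
  compatible-separated {u} {v} {x} {y} u≉x below above =
    mk⇔ (⊥-elim ∘ u≉x) (⊥-elim ∘ v≉y) , mk⇔ above reflect-above
    where
    v≉y : ¬ v ≈ y
    v≉y v≈y with compare x u
    ... | tri< x<u _ _ = irrefl (Eq.sym v≈y) (below x<u)
    ... | tri≈ _ x≈u _ = u≉x (Eq.sym x≈u)
    ... | tri> _ _ u<x = irrefl v≈y (above u<x)

    reflect-above : v < y → u < x
    reflect-above v<y with compare x u
    ... | tri< x<u _ _ = ⊥-elim (asym v<y (below x<u))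
    ... | tri≈ _ x≈u _ = ⊥-elim (u≉x (Eq.sym x≈u))
    ... | tri> _ _ u<x = u<x

  IsPartialAut-∷ : ∀ {p h} → IsPartialAut L h → (∀ {q} → q ∈ h → Compatible p q) →
    IsPartialAut L (p ∷ h)
  IsPartialAut-∷ {p} pa p≅h (here ≡-refl) (here ≡-refl) = compatible-refl p
  IsPartialAut-∷     pa p≅h (here ≡-refl) (there n)     = p≅h n
  IsPartialAut-∷     pa p≅h (there m)     (here ≡-refl) = compatible-sym (p≅h m)
  IsPartialAut-∷     pa p≅h (there m)     (there n)     = pa m n

  IsPartialAut-⊆ : ∀ {h h′} → h′ ⊆ h → IsPartialAut L h → IsPartialAut L h′
  IsPartialAut-⊆ h′⊆h pa m n = pa (h′⊆h m) (h′⊆h n)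

  IsPartialAut-converse : ∀ {h h′} → (∀ {x y} → (x , y) ∈ h′ → (y , x) ∈ h) →
    IsPartialAut L h → IsPartialAut L h′
  IsPartialAut-converse h′⊆h⁻¹ pa m n =
    let e , o = pa (h′⊆h⁻¹ m) (h′⊆h⁻¹ n) in ⇔-sym e , ⇔-sym o

  ∈-inverse⁺ : ∀ {x y : A} {h} → (x , y) ∈ h → (y , x) ∈ map swap h
  ∈-inverse⁺ = ∈-map⁺ swap

  ∈-inverse⁻ : ∀ {x y : A} {h} → (x , y) ∈ map swap h → (y , x) ∈ h
  ∈-inverse⁻ m with ∈-map⁻ swap m
  ... | _ , n , ≡-refl = n

  IsPartialAut-inverse : ∀ {h} → IsPartialAut L h → IsPartialAut L (map swap h)
  IsPartialAut-inverse = IsPartialAut-converse ∈-inverse⁻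

  _∈dom_ : A → List (A × A) → Set (c ⊔ ℓ₁)
  u ∈dom h = Any (λ p → u ≈ proj₁ p) h

  images-below : A → List (A × A) → List A
  images-below u h = map proj₂ (filter (λ p → proj₁ p <? u) h)

  images-above : A → List (A × A) → List A
  images-above u h = map proj₂ (filter (λ p → u <? proj₁ p) h)

  ∈-images-below⁺ : ∀ {u x y h} → (x , y) ∈ h → x < u → y ∈ images-below u h
  ∈-images-below⁺ m x<u = ∈-map⁺ proj₂ (∈-filter⁺ _ m x<u)

  ∈-images-above⁺ : ∀ {u x y h} → (x , y) ∈ h → u < x → y ∈ images-above u h
  ∈-images-above⁺ m u<x = ∈-map⁺ proj₂ (∈-filter⁺ _ m u<x)

  ∈-images-below⁻ : ∀ {u y h} → y ∈ images-below u h → ∃[ x ] ((x , y) ∈ h × x < u)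
  ∈-images-below⁻ m with ∈-map⁻ proj₂ m
  ... | (x , _) , n , ≡-refl = x , ∈-filter⁻ _ n

  ∈-images-above⁻ : ∀ {u y h} → y ∈ images-above u h → ∃[ x ] ((x , y) ∈ h × u < x)
  ∈-images-above⁻ m with ∈-map⁻ proj₂ m
  ... | (x , _) , n , ≡-refl = x , ∈-filter⁻ _ n

  images-below<above : ∀ {u h} → IsPartialAut L h →
    All (λ l → All (l <_) (images-above u h)) (images-below u h)
  images-below<above pa = All.tabulate λ l∈ → All.tabulate λ r∈ →
    let _ , m , x<u = ∈-images-below⁻ l∈
        _ , n , u<x′ = ∈-images-above⁻ r∈
    in to (proj₂ (pa m n)) (trans x<u u<x′)

  extend-in-domain : ∀ {h x y u} → IsPartialAut L h → (x , y) ∈ h → x ≈ u →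
    IsPartialAut L ((u , y) ∷ h)
  extend-in-domain pa m x≈u = IsPartialAut-∷ pa (compatible-respˡ x≈u ∘ pa m)

  extend-outside-domain : Dense L → NoLeast L → ∀ {h x₀ y₀ u} → IsPartialAut L h →
    (x₀ , y₀) ∈ h → u < x₀ → ¬ u ∈dom h → ∃[ v ] IsPartialAut L ((u , v) ∷ h)
  extend-outside-domain dense noleast pa m₀ u<x₀ u∉dom =
    let v , below<v , v<above = interpolate dense noleast (∈-images-above⁺ m₀ u<x₀)
                                                          (images-below<above pa)
    in v , IsPartialAut-∷ pa λ m →
         compatible-separated (u∉dom ∘ lose m)
                              (All.lookup below<v ∘ ∈-images-below⁺ m)
                              (All.lookup v<above ∘ ∈-images-above⁺ m)

  extend : Dense L → NoLeast L → ∀ {h x₀ y₀ u} → IsPartialAut L h →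
    (x₀ , y₀) ∈ h → u ≤ x₀ → ∃[ v ] IsPartialAut L ((u , v) ∷ h)
  extend dense noleast {h} {x₀} {u = u} pa m₀ u≤x₀ with any? (λ p → u ≟ proj₁ p) h
  ... | yes u∈dom = let (_ , y) , m , u≈x = find u∈dom
                    in y , extend-in-domain pa m (Eq.sym u≈x)
  ... | no u∉dom  = extend-outside-domain dense noleast pa m₀ (strict u≤x₀) u∉dom
    where
    strict : u ≤ x₀ → u < x₀
    strict (inj₁ u<x₀) = u<x₀
    strict (inj₂ u≈x₀) = ⊥-elim (u∉dom (lose m₀ u≈x₀))

proposition3p3 : ∀ {c ℓ₁ ℓ₂} (L : StrictTotalOrder c ℓ₁ ℓ₂) →
    Dense L → NoLeast L →
    (g : List (StrictTotalOrder.Carrier L × StrictTotalOrder.Carrier L)) →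
    IsPartialAut L g →
    (a ga b : StrictTotalOrder.Carrier L) → (a , ga) ∈ g →
    _≤L_ L b ga → _≤L_ L ga a →
    ∃[ d₁ ] ∃[ d₂ ] IsPartialAut L ((d₁ , b) ∷ (b , d₂) ∷ g)
proposition3p3 L dense noleast g pa a ga b m b≤ga ga≤a =
  let d₁ , pa₁ = extend L dense noleast (IsPartialAut-inverse L pa) (∈-inverse⁺ L m) b≤ga
      pa₁′ : IsPartialAut L ((d₁ , b) ∷ g)
      pa₁′ = IsPartialAut-converse L (λ { (here ≡-refl) → here ≡-refl
                                        ; (there n) → there (∈-inverse⁺ L n) }) pa₁
      d₂ , pa₂ = extend L dense noleast pa₁′ (there m) (≤L-trans L b≤ga ga≤a)
  in d₁ , d₂ , IsPartialAut-⊆ L (∈-resp-↭ (↭-swap _ _ ↭-refl)) pa₂
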